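{- Let $D$ be an $m$-colored digraph such that for every vertex $x\in V(D)$ there exists an alternating $xw$-walk for some vertex $w$ such that the arcs entering $w$ and the arcs leaving $w$ have no colors in common. Then $D$ has a kernel by alternating (properly colored) walks.
   Context: An $m$-colored digraph is a finite loopless digraph whose arcs are colored with $m$ colors. A walk is alternating (properly colored) if any two consecutive arcs have different colors. A kernel by alternating walks is a set $S\subseteq V(D)$ such that no two different vertices of $S$ are joined by an alternating walk, and every vertex not in $S$ has an alternating walk to some vertex of $S$. -}

module Defs where

open import Data.Nat using (ℕ)
open import Data.Fin using (Fin)
open import Data.Fin.Subset using (Subset; _∈_; _∉_)
open import Data.Maybe using (Maybe; just; nothing)
open import Data.Product using (Σ; ∃; ∃-syntax; _×_)
open import Data.Sum using (_⊎_)
open import Relation.Binary.PropositionalEquality using (_≡_; _≢_)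
open import Relation.Nullary using (¬_)

-- An m-colored digraph on the vertex set Fin n: for each ordered pair (u,v),
-- colour u v = just c means there is an arc u → v of colour c, nothing means no arc.
record ColoredDigraph (n m : ℕ) : Set where
  field
    colour   : Fin n → Fin n → Maybe (Fin m)
    loopless : ∀ v → colour v v ≡ nothing

module _ {n m : ℕ} (D : ColoredDigraph n m) where
  open ColoredDigraph D

  data AltWalkFrom : Fin n → Fin n → Fin m → Set where
    single : ∀ {x y c} → colour x y ≡ just c → AltWalkFrom x y c
    cons   : ∀ {x y z c c'} → colour x y ≡ just c → c ≢ c' →
             AltWalkFrom y z c' → AltWalkFrom x z c

  AltWalk : Fin n → Fin n → Set
  AltWalk x y = ∃[ c ] AltWalkFrom x y c

  InOutDisjoint : Fin n → Set
  InOutDisjoint w = ¬ (∃[ u ] ∃[ v ] ∃[ c ] (colour u w ≡ just c × colour w v ≡ just c))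

  IsAltKernel : Subset n → Set
  IsAltKernel S =
    (∀ x y → x ∈ S → y ∈ S → x ≢ y → ¬ AltWalk x y)
    × (∀ x → x ∉ S → ∃[ y ] (y ∈ S × AltWalk x y))

-- Call w a switch if the colours entering w and leaving w are disjoint. Alternating walks can
-- be concatenated at a switch, so "u has an alternating walk to the switch v" is a transitive
-- relation ⇝. For any decidable transitive relation on a finite set, taking in every terminal
-- strongly connected class its least vertex gives a set with no ⇝ between distinct members
-- that every vertex reaches. By hypothesis every vertex walks into a switch, hence into a
-- chosen vertex, so the chosen switches form a kernel by alternating walks. The set can be
-- computed because reachability among (vertex, first colour) states is decidable.
module Submission where

open import Defs
open import Level using (Level; 0ℓ)
open import Data.Nat using (ℕ)
open import Data.Fin using (Fin; _<_)
open import Data.Fin.Properties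
  using (any?; all?; ¬∀⟶∃¬; _<?_; <-cmp; <-irrefl; <-trans; *↔×) renaming (_≟_ to _≟ᶠ_)
open import Data.Fin.Induction using (spo-wellFounded)
open import Data.Fin.Subset using (Subset; _∈_; _∉_; _⊂_; _⊃_; ⊥)
open import Data.Fin.Subset.Properties using (_∈?_; _⊂?_; ∉⊥)
open import Data.Fin.Subset.Induction using (⊃-wellFounded)
open import Data.Maybe using (just)
open import Data.Maybe.Properties using (≡-dec)
open import Data.Product using (∃-syntax; _×_; _,_; proj₁; proj₂)
open import Data.Sum using (_⊎_; inj₁; inj₂)
open import Data.Vec using (tabulate)
open import Data.Vec.Properties using (lookup∘tabulate; []=⇒lookup; lookup⇒[]=)
open import Function using (_∘_; _↔_; Inverse)
open import Induction.WellFounded using (Acc; acc)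
open import Relation.Binary using (Rel; Decidable; Transitive; IsStrictPartialOrder; tri<; tri≈; tri>)
open import Relation.Binary.PropositionalEquality
  using (_≡_; _≢_; refl; sym; trans; subst; isEquivalence; resp₂)
open import Relation.Nullary using (¬_; Dec; yes; no; contradiction)
open import Relation.Nullary.Decidable
  using (does; dec-true; decidable-stable; map′; ¬?; _×-dec_; _⊎-dec_)
open import Relation.Unary using (Pred) renaming (Decidable to Decidable₁)

private
  variable
    ℓ : Level
    N : ℕ

module _ {P : Pred (Fin N) ℓ} (P? : Decidable₁ P) where

  subset : Subset N
  subset = tabulate (does ∘ P?)

  ∈-subset⁺ : ∀ {i} → P i → i ∈ subset
  ∈-subset⁺ {i} p = lookup⇒[]= i subset (trans (lookup∘tabulate _ i) (dec-true (P? i) p))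

  ∈-subset⁻ : ∀ {i} → i ∈ subset → P i
  ∈-subset⁻ {i} i∈ with P? i | trans (sym (lookup∘tabulate (does ∘ P?) i)) ([]=⇒lookup i∈)
  ... | yes p | _ = p
  ... | no _  | ()

module Reachability {A : Set} (enum : Fin N ↔ A)
  {Goal : Pred A ℓ} (Goal? : Decidable₁ Goal) {Edge : Rel A ℓ} (Edge? : Decidable Edge) where

  open Inverse enum using (to; from; strictlyInverseˡ)

  data Reach : A → Set ℓ where
    base : ∀ {a} → Goal a → Reach a
    step : ∀ {a b} → Edge a b → Reach b → Reach a

  Grows : Subset N → Pred (Fin N) ℓ
  Grows R i = i ∈ R ⊎ Goal (to i) ⊎ ∃[ j ] (Edge (to i) (to j) × j ∈ R)

  grows? : ∀ R → Decidable₁ (Grows R)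
  grows? R i = i ∈? R ⊎-dec Goal? (to i) ⊎-dec any? λ j → Edge? (to i) (to j) ×-dec j ∈? R

  grow : Subset N → Subset N
  grow R = subset (grows? R)

  Sound : Subset N → Set ℓ
  Sound R = ∀ {i} → i ∈ R → Reach (to i)

  grow-sound : ∀ {R} → Sound R → Sound (grow R)
  grow-sound {R} sound i∈ with ∈-subset⁻ (grows? R) i∈
  ... | inj₁ i∈R                  = sound i∈R
  ... | inj₂ (inj₁ goal)          = base goal
  ... | inj₂ (inj₂ (j , e , j∈R)) = step e (sound j∈R)

  stable⇒grow⊆ : ∀ {R i} → ¬ R ⊂ grow R → i ∈ grow R → i ∈ R
  stable⇒grow⊆ {R} {i} stable i∈ with i ∈? R
  ... | yes i∈R = i∈R
  ... | no  i∉R = contradiction ((λ {j} j∈R → ∈-subset⁺ (grows? R) (inj₁ j∈R)) , i , i∈ , i∉R) stable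

  stable-complete : ∀ {R a} → ¬ R ⊂ grow R → Reach a → from a ∈ R
  stable-complete {R} {a} stable (base goal) =
    stable⇒grow⊆ stable (∈-subset⁺ (grows? R) (inj₂ (inj₁ (subst Goal (sym (strictlyInverseˡ a)) goal))))
  stable-complete {R} {a} stable (step {b = b} e r) =
    stable⇒grow⊆ stable (∈-subset⁺ (grows? R) (inj₂ (inj₂ (from b , edge , stable-complete stable r))))
    where
    edge : Edge (to (from a)) (to (from b))
    edge rewrite strictlyInverseˡ a | strictlyInverseˡ b = e

  lfp : ∀ R → Acc _⊃_ R → Sound R → ∃[ R′ ] (Sound R′ × ¬ R′ ⊂ grow R′)
  lfp R (acc rec) sound with R ⊂? grow R
  ... | yes R⊂ = lfp (grow R) (rec R⊂) (grow-sound sound)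
  ... | no  R⊄ = R , sound , R⊄

  reach? : Decidable₁ Reach
  reach? a with lfp ⊥ (⊃-wellFounded ⊥) (λ i∈⊥ → contradiction i∈⊥ ∉⊥)
  ... | R , sound , stable =
    map′ (subst Reach (strictlyInverseˡ a) ∘ sound) (stable-complete stable) (from a ∈? R)

module Sinks {n} {_⇝_ : Rel (Fin n) ℓ} (_⇝?_ : Decidable _⇝_) (⇝-trans : Transitive _⇝_) where

  -- u ⊏ w: u lies in a strictly later class than w, or in the same class with a smaller index.
  _⊏_ : Rel (Fin n) ℓ
  u ⊏ w = w ⇝ u × (¬ u ⇝ w ⊎ u < w)

  _⊏?_ : Decidable _⊏_
  u ⊏? w = w ⇝? u ×-dec (¬? (u ⇝? w) ⊎-dec u <? w)

  ⊏-trans : Transitive _⊏_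
  ⊏-trans {v} {u} {w} (u⇝v , vu) (w⇝u , uw) = ⇝-trans w⇝u u⇝v , later vu uw
    where
    later : ¬ v ⇝ u ⊎ v < u → ¬ u ⇝ w ⊎ u < w → ¬ v ⇝ w ⊎ v < w
    later _          (inj₁ u↛w) = inj₁ λ v⇝w → u↛w (⇝-trans u⇝v v⇝w)
    later (inj₁ v↛u) (inj₂ _)   = inj₁ λ v⇝w → v↛u (⇝-trans v⇝w w⇝u)
    later (inj₂ v<u) (inj₂ u<w) = inj₂ (<-trans v<u u<w)

  ⊏-isStrictPartialOrder : IsStrictPartialOrder _≡_ _⊏_
  ⊏-isStrictPartialOrder = record
    { isEquivalence = isEquivalence
    ; irrefl        = λ { refl (u⇝u , inj₁ u↛u) → u↛u u⇝u
                        ; refl (_   , inj₂ u<u) → <-irrefl refl u<u }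
    ; trans         = ⊏-trans
    ; <-resp-≈      = resp₂ _⊏_
    }

  IsSink : Pred (Fin n) ℓ
  IsSink w = ∀ u → ¬ u ⊏ w

  isSink? : Decidable₁ IsSink
  isSink? w = all? λ u → ¬? (u ⊏? w)

  sinks-independent : ∀ {s t} → IsSink s → IsSink t → s ⇝ t → s ≡ t
  sinks-independent {s} {t} sink-s sink-t s⇝t with <-cmp s t
  ... | tri< s<t _ _ = contradiction (t⇝s , inj₂ s<t) (sink-t s)
    where t⇝s = decidable-stable (t ⇝? s) λ t↛s → sink-s t (s⇝t , inj₁ t↛s)
  ... | tri≈ _ s≡t _ = s≡t
  ... | tri> _ _ t<s = contradiction (s⇝t , inj₂ t<s) (sink-s t)

  reaches-sink : ∀ w → ∃[ s ] (IsSink s × (w ≡ s ⊎ w ⇝ s))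
  reaches-sink w = go w (spo-wellFounded ⊏-isStrictPartialOrder w)
    where
    go : ∀ w → Acc _⊏_ w → ∃[ s ] (IsSink s × (w ≡ s ⊎ w ⇝ s))
    go w (acc rec) with isSink? w
    ... | yes sink = w , sink , inj₁ refl
    ... | no ¬sink with ¬∀⟶∃¬ n _ (λ u → ¬? (u ⊏? w)) ¬sink
    ... | u , ¬¬u⊏w with decidable-stable (u ⊏? w) ¬¬u⊏w
    ... | u⊏w@(w⇝u , _) with go u (rec u⊏w)
    ... | s , sink , inj₁ refl = s , sink , inj₂ w⇝u
    ... | s , sink , inj₂ u⇝s  = s , sink , inj₂ (⇝-trans w⇝u u⇝s)

module _ {n m} (D : ColoredDigraph n m) where
  open ColoredDigraph D

  firstArc : ∀ {w y c} → AltWalkFrom D w y c → ∃[ v ] colour w v ≡ just c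
  firstArc (single e)   = _ , e
  firstArc (cons e _ _) = _ , e

  _++⟨_⟩_ : ∀ {x w y c c′} → AltWalkFrom D x w c → InOutDisjoint D w → AltWalkFrom D w y c′ →
            AltWalkFrom D x y c
  _++⟨_⟩_ {x} {c′ = c′} (single e) disjoint q = cons e c≢c′ q
    where
    c≢c′ : _ ≢ c′
    c≢c′ refl = let v , e′ = firstArc q in disjoint (x , v , c′ , e , e′)
  cons e c≢c′ p ++⟨ disjoint ⟩ q = cons e c≢c′ (p ++⟨ disjoint ⟩ q)

  altWalk-trans : ∀ {x w y} → AltWalk D x w → InOutDisjoint D w → AltWalk D w y → AltWalk D x y
  altWalk-trans (c , p) disjoint (_ , q) = c , p ++⟨ disjoint ⟩ q

  inOutDisjoint? : Decidable₁ (InOutDisjoint D)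
  inOutDisjoint? w = ¬? (any? λ u → any? λ v → any? λ c →
    ≡-dec _≟ᶠ_ (colour u w) (just c) ×-dec ≡-dec _≟ᶠ_ (colour w v) (just c))

  module _ (z : Fin n) where

    ArcInto : Pred (Fin n × Fin m) 0ℓ
    ArcInto (x , c) = colour x z ≡ just c

    AlternatingArc : Rel (Fin n × Fin m) 0ℓ
    AlternatingArc (x , c) (y , c′) = colour x y ≡ just c × c ≢ c′

    arcInto? : Decidable₁ ArcInto
    arcInto? (x , c) = ≡-dec _≟ᶠ_ (colour x z) (just c)

    alternatingArc? : Decidable AlternatingArc
    alternatingArc? (x , c) (y , c′) = ≡-dec _≟ᶠ_ (colour x y) (just c) ×-dec ¬? (c ≟ᶠ c′)

    open Reachability (*↔× {n} {m}) arcInto? alternatingArc?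

    reach⇒altWalkFrom : ∀ {x c} → Reach (x , c) → AltWalkFrom D x z c
    reach⇒altWalkFrom (base e)                        = single e
    reach⇒altWalkFrom (step {b = _ , _} (e , c≢c′) r) = cons e c≢c′ (reach⇒altWalkFrom r)

    altWalkFrom⇒reach : ∀ {x c} → AltWalkFrom D x z c → Reach (x , c)
    altWalkFrom⇒reach (single e)      = base e
    altWalkFrom⇒reach (cons e c≢c′ p) = step (e , c≢c′) (altWalkFrom⇒reach p)

    altWalkFrom? : ∀ x c → Dec (AltWalkFrom D x z c)
    altWalkFrom? x c = map′ reach⇒altWalkFrom altWalkFrom⇒reach (reach? (x , c))

  altWalk? : Decidable (AltWalk D)
  altWalk? x y = any? (altWalkFrom? y x)

  _⇝_ : Rel (Fin n) 0ℓ
  u ⇝ v = AltWalk D u v × InOutDisjoint D v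

  ⇝-trans : Transitive _⇝_
  ⇝-trans (p , disjoint) (q , disjoint′) = altWalk-trans p disjoint q , disjoint′

  _⇝?_ : Decidable _⇝_
  u ⇝? v = altWalk? u v ×-dec inOutDisjoint? v

  open Sinks _⇝?_ ⇝-trans

  Chosen : Pred (Fin n) 0ℓ
  Chosen s = InOutDisjoint D s × IsSink s

  chosen? : Decidable₁ Chosen
  chosen? s = inOutDisjoint? s ×-dec isSink? s

  chosen : Subset n
  chosen = subset chosen?

  chosen-independent : ∀ x y → x ∈ chosen → y ∈ chosen → x ≢ y → ¬ AltWalk D x y
  chosen-independent x y x∈ y∈ x≢y p = x≢y (sinks-independent sink-x sink-y (p , disjoint-y))
    where
    sink-x = proj₂ (∈-subset⁻ chosen? x∈)
    sink-y = proj₂ (∈-subset⁻ chosen? y∈)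
    disjoint-y = proj₁ (∈-subset⁻ chosen? y∈)

  chosen-absorbing : (∀ x → ∃[ w ] ((x ≡ w ⊎ AltWalk D x w) × InOutDisjoint D w)) →
                     ∀ x → x ∉ chosen → ∃[ y ] (y ∈ chosen × AltWalk D x y)
  chosen-absorbing hyp x x∉ with hyp x
  ... | w , x→w , disjoint with reaches-sink w
  ... | s , sink , w→s = s , ∈-subset⁺ chosen? (disjoint-s w→s , sink) , walk x→w w→s
    where
    disjoint-s : w ≡ s ⊎ w ⇝ s → InOutDisjoint D s
    disjoint-s (inj₁ refl)    = disjoint
    disjoint-s (inj₂ (_ , d)) = d

    walk : x ≡ w ⊎ AltWalk D x w → w ≡ s ⊎ w ⇝ s → AltWalk D x s
    walk (inj₁ refl) (inj₁ refl)    = contradiction (∈-subset⁺ chosen? (disjoint , sink)) x∉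
    walk (inj₁ refl) (inj₂ (q , _)) = q
    walk (inj₂ p)    (inj₁ refl)    = p
    walk (inj₂ p)    (inj₂ (q , _)) = altWalk-trans p disjoint q

corollary2 : ∀ {n m : ℕ} (D : ColoredDigraph n m) →
    (∀ x → ∃[ w ] ((x ≡ w ⊎ AltWalk D x w) × InOutDisjoint D w)) →
    ∃[ S ] IsAltKernel D S
corollary2 D hyp = chosen D , chosen-independent D , chosen-absorbing D hyp
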